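{- Let $N = q^k n^2$ be an odd perfect number, where $q$ is a prime with $q \equiv k \equiv 1 \pmod 4$ and $\gcd(q,n)=1$. Then $k=1$ if and only if $\frac{\sigma(n^2)}{q}$ is an integer dividing $n^2$.
   Context: For a positive integer $N$, $\sigma(N)$ denotes the sum of the positive divisors of $N$; $N$ is perfect if $\sigma(N)=2N$. -}

module Defs where

open import Data.Nat using (ℕ; zero; suc; _+_; _*_)
open import Data.Nat.Divisibility using (_∣?_)
open import Data.List using (List; filter)
open import Data.Nat.ListAction using (sum)
open import Relation.Binary.PropositionalEquality using (_≡_)
open import Data.List using (upTo)
open import Data.List using (map)

oneTo : ℕ → List ℕ
oneTo N = map suc (upTo N)

-- σ N = sum of the positive divisors of N  (σ 0 = 0, never used)
σ : ℕ → ℕ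
σ N = sum (filter (λ d → d ∣? N) (oneTo N))

Perfect : ℕ → Set
Perfect N = σ N ≡ 2 * N

-- σ is multiplicative and σ(q^k) is prime to q, so q^k ∣ σ(n²). If k = 1 then
-- (q + 1) σ(n²) = 2 q n², hence σ(n²) = q d with d · (q + 1)/2 = n². Conversely, if
-- σ(n²) = q d with d ∣ n², then q^(k-1) divides d, which is prime to q, so k ≤ 1;
-- and k ≡ 1 (mod 4) excludes k = 0.
module Submission where

open import Defs
open import Data.Nat
open import Data.Nat.Properties
open import Data.Nat.Divisibility
open import Data.Nat.DivMod using (m≡m%n+[m/n]*n; m*n/n≡m; m∣n⇒o%n%m≡o%m)
open import Data.Nat.GCD using (gcd; gcd[m,n]∣m; gcd[m,n]∣n; gcd[m,n]≢0)
open import Data.Nat.Coprimality as Coprimality using (Coprime; coprime-divisor; coprime-/gcd)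
open import Data.Nat.Primality using (Prime; prime⇒irreducible; prime⇒nonZero; prime⇒nonTrivial)
open import Data.Nat.ListAction using (sum)
open import Data.Nat.ListAction.Properties using (sum-++; sum-↭)
open import Data.Nat.Tactic.RingSolver using (solve-∀)
open import Data.List using (List; []; _∷_; _++_; map; filter; cartesianProduct)
open import Data.List.Properties using (map-++; map-∘)
open import Data.List.Membership.Propositional using (_∈_)
open import Data.List.Membership.Propositional.Properties
  using (∈-filter⁺; ∈-filter⁻; ∈-map⁺; ∈-map⁻; ∈-upTo⁺; ∈-cartesianProduct⁺; ∈-cartesianProduct⁻)
open import Data.List.Membership.Propositional.Properties.WithK using (unique∧set⇒bag)
open import Data.List.Relation.Binary.BagAndSetEquality using (_∼[_]_; set; ∼bag⇒↭)
open import Data.List.Relation.Unary.All as All using (All; []; _∷_)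
open import Data.List.Relation.Unary.All.Properties using (all-filter; map⁺)
open import Data.List.Relation.Unary.Any using (here; there)
open import Data.List.Relation.Unary.Unique.Propositional using (Unique; []; _∷_)
import Data.List.Relation.Unary.Unique.Propositional.Properties as Unique
open import Data.Product using (_×_; _,_; proj₁; proj₂; ∃-syntax; uncurry)
open import Data.Sum using (_⊎_; inj₁; inj₂)
open import Function using (_∘_)
open import Function.Bundles using (_⇔_; mk⇔)
open import Relation.Binary.PropositionalEquality
open import Relation.Nullary using (¬_; yes; no; contradiction)

open ≡-Reasoning

unique∧set⇒sum≡ : ∀ {ms ns : List ℕ} → Unique ms → Unique ns → ms ∼[ set ] ns → sum ms ≡ sum ns
unique∧set⇒sum≡ ms! ns! ms≈ns = sum-↭ (∼bag⇒↭ (unique∧set⇒bag ms! ns! ms≈ns))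

map⁺-injectiveOn : ∀ {A B : Set} (f : A → B) {xs : List A} →
  (∀ {x y} → x ∈ xs → y ∈ xs → f x ≡ f y → x ≡ y) → Unique xs → Unique (map f xs)
map⁺-injectiveOn f inj []           = []
map⁺-injectiveOn f inj (x∉xs ∷ xs!) =
  map⁺ (All.tabulate λ y∈xs fx≡fy → All.lookup x∉xs y∈xs (inj (here refl) (there y∈xs) fx≡fy))
  ∷ map⁺-injectiveOn f (λ x∈ y∈ → inj (there x∈) (there y∈)) xs!

∣-sum : ∀ {d ns} → All (d ∣_) ns → d ∣ sum ns
∣-sum {d} []       = d ∣0
∣-sum (d∣n ∷ d∣ns) = ∣m∣n⇒∣m+n d∣n (∣-sum d∣ns)

sum-map-*ˡ : ∀ m ns → sum (map (m *_) ns) ≡ m * sum ns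
sum-map-*ˡ m []       = sym (*-zeroʳ m)
sum-map-*ˡ m (n ∷ ns) = begin
  m * n + sum (map (m *_) ns) ≡⟨ cong (m * n +_) (sum-map-*ˡ m ns) ⟩
  m * n + m * sum ns          ≡⟨ *-distribˡ-+ m n (sum ns) ⟨
  m * (n + sum ns)            ∎

sum-cartesianProduct : ∀ ms ns →
  sum (map (uncurry _*_) (cartesianProduct ms ns)) ≡ sum ms * sum ns
sum-cartesianProduct []       ns = refl
sum-cartesianProduct (m ∷ ms) ns = begin
  sum (map (uncurry _*_) (map (m ,_) ns ++ cartesianProduct ms ns))
    ≡⟨ cong sum (map-++ (uncurry _*_) (map (m ,_) ns) _) ⟩
  sum (map (uncurry _*_) (map (m ,_) ns) ++ map (uncurry _*_) (cartesianProduct ms ns))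
    ≡⟨ sum-++ (map (uncurry _*_) (map (m ,_) ns)) _ ⟩
  sum (map (uncurry _*_) (map (m ,_) ns)) + sum (map (uncurry _*_) (cartesianProduct ms ns))
    ≡⟨ cong₂ _+_ (trans (cong sum (sym (map-∘ ns))) (sum-map-*ˡ m ns)) (sum-cartesianProduct ms ns) ⟩
  m * sum ns + sum ms * sum ns
    ≡⟨ *-distribʳ-+ (sum ns) m (sum ms) ⟨
  (m + sum ms) * sum ns ∎

divisors : ℕ → List ℕ
divisors n = filter (_∣? n) (oneTo n)

divisors-unique : ∀ n → Unique (divisors n)
divisors-unique n = Unique.filter⁺ (_∣? n) (Unique.map⁺ suc-injective (Unique.upTo⁺ n))

∈-divisors⁻ : ∀ n {d} → d ∈ divisors n → d ∣ n
∈-divisors⁻ n d∈ = proj₂ (∈-filter⁻ (_∣? n) {xs = oneTo n} d∈)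

∈-divisors⁺ : ∀ {n d} .{{_ : NonZero n}} → d ∣ n → d ∈ divisors n
∈-divisors⁺ {n} {zero}  0∣n = contradiction (0∣⇒≡0 0∣n) (≢-nonZero⁻¹ n)
∈-divisors⁺ {n} {suc d} d∣n = ∈-filter⁺ (_∣? n) (∈-map⁺ suc (∈-upTo⁺ (∣⇒≤ d∣n))) d∣n

σ≡sum : ∀ {n ds} .{{_ : NonZero n}} → Unique ds →
  (∀ {d} → d ∣ n → d ∈ ds) → (∀ {d} → d ∈ ds → d ∣ n) → σ n ≡ sum ds
σ≡sum {n} ds! ∣⇒∈ ∈⇒∣ = unique∧set⇒sum≡ (divisors-unique n) ds!
  (mk⇔ (∣⇒∈ ∘ ∈-divisors⁻ n) (∈-divisors⁺ ∘ ∈⇒∣))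

-- With g = gcd d a, d/g is prime to a/g and divides (a/g) b, hence divides b.
coprime-∣-*-split : ∀ {a b d} .{{_ : NonZero a}} → Coprime a b → d ∣ a * b →
  ∃[ x ] ∃[ y ] (x ∣ a × y ∣ b × d ≡ x * y)
coprime-∣-*-split {a} {b} {d} a⊥b (divides c ab≡cd)
  with gcd[m,n]∣m d a | gcd[m,n]∣n d a
... | divides e d≡eg | divides a′ a≡a′g = g , e , gcd[m,n]∣n d a , e∣b , trans d≡eg (*-comm e g)
  where
  g = gcd d a
  instance
    g≢0 : NonZero g
    g≢0 = ≢-nonZero (gcd[m,n]≢0 d a (inj₂ (≢-nonZero⁻¹ a)))
  e⊥a′ : Coprime e a′
  e⊥a′ = subst₂ Coprime (trans (cong (_/ g) d≡eg) (m*n/n≡m e g))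
    (trans (cong (_/ g) a≡a′g) (m*n/n≡m a′ g)) (coprime-/gcd d a)
  a′b≡ce : a′ * b ≡ c * e
  a′b≡ce = *-cancelʳ-≡ _ _ g (begin
    a′ * b * g   ≡⟨ *-assoc a′ b g ⟩
    a′ * (b * g) ≡⟨ cong (a′ *_) (*-comm b g) ⟩
    a′ * (g * b) ≡⟨ *-assoc a′ g b ⟨
    a′ * g * b   ≡⟨ cong (_* b) a≡a′g ⟨
    a * b        ≡⟨ ab≡cd ⟩
    c * d        ≡⟨ cong (c *_) d≡eg ⟩
    c * (e * g)  ≡⟨ *-assoc c e g ⟨
    c * e * g    ∎)
  e∣b : e ∣ b
  e∣b = coprime-divisor e⊥a′ (divides c a′b≡ce)

coprime-divisors-∣ : ∀ {a b x y u v} → Coprime a b → x ∣ a → v ∣ b → x * y ≡ u * v → x ∣ u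
coprime-divisors-∣ {y = y} {u} {v} a⊥b x∣a v∣b xy≡uv =
  coprime-divisor (λ (c∣x , c∣v) → a⊥b (∣-trans c∣x x∣a , ∣-trans c∣v v∣b))
    (divides y (trans (*-comm v u) (trans (sym xy≡uv) (*-comm _ y))))

coprime-divisors-*-injective : ∀ {a b x₁ y₁ x₂ y₂} → Coprime a b →
  x₁ ∣ a → y₁ ∣ b → x₂ ∣ a → y₂ ∣ b → x₁ * y₁ ≡ x₂ * y₂ → (x₁ , y₁) ≡ (x₂ , y₂)
coprime-divisors-*-injective {x₁ = x₁} {y₁} {x₂} {y₂} a⊥b x₁∣a y₁∣b x₂∣a y₂∣b eq =
  cong₂ _,_
    (∣-antisym (coprime-divisors-∣ a⊥b x₁∣a y₂∣b eq) (coprime-divisors-∣ a⊥b x₂∣a y₁∣b (sym eq)))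
    (∣-antisym (coprime-divisors-∣ b⊥a y₁∣b x₂∣a eq′) (coprime-divisors-∣ b⊥a y₂∣b x₁∣a (sym eq′)))
  where
  b⊥a = Coprimality.sym a⊥b
  eq′ : y₁ * x₁ ≡ y₂ * x₂
  eq′ = trans (*-comm y₁ x₁) (trans eq (*-comm x₂ y₂))

σ-*-coprime : ∀ {a b} .{{_ : NonZero a}} .{{_ : NonZero b}} → Coprime a b → σ (a * b) ≡ σ a * σ b
σ-*-coprime {a} {b} a⊥b = trans
  (σ≡sum {{m*n≢0 a b}} products! ∣⇒∈ ∈⇒∣)
  (sum-cartesianProduct (divisors a) (divisors b))
  where
  pairs = cartesianProduct (divisors a) (divisors b)
  products! : Unique (map (uncurry _*_) pairs)
  products! = map⁺-injectiveOn (uncurry _*_)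
    (λ p∈ q∈ → let (x₁∈ , y₁∈) = ∈-cartesianProduct⁻ (divisors a) (divisors b) p∈
                   (x₂∈ , y₂∈) = ∈-cartesianProduct⁻ (divisors a) (divisors b) q∈
               in coprime-divisors-*-injective a⊥b (∈-divisors⁻ a x₁∈) (∈-divisors⁻ b y₁∈)
                    (∈-divisors⁻ a x₂∈) (∈-divisors⁻ b y₂∈))
    (Unique.cartesianProduct⁺ (divisors-unique a) (divisors-unique b))
  ∣⇒∈ : ∀ {d} → d ∣ a * b → d ∈ map (uncurry _*_) pairs
  ∣⇒∈ d∣ab with coprime-∣-*-split a⊥b d∣ab
  ... | x , y , x∣a , y∣b , refl = ∈-map⁺ (uncurry _*_) (∈-cartesianProduct⁺ (∈-divisors⁺ x∣a) (∈-divisors⁺ y∣b))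
  ∈⇒∣ : ∀ {d} → d ∈ map (uncurry _*_) pairs → d ∣ a * b
  ∈⇒∣ d∈ with ∈-map⁻ (uncurry _*_) d∈
  ... | (x , y) , xy∈ , refl = let (x∈ , y∈) = ∈-cartesianProduct⁻ (divisors a) (divisors b) xy∈
                               in *-pres-∣ (∈-divisors⁻ a x∈) (∈-divisors⁻ b y∈)

prime≢1 : ∀ {p} → Prime p → p ≢ 1
prime≢1 p-prime = nonTrivial⇒≢1 {{prime⇒nonTrivial p-prime}}

prime∤⇒coprime : ∀ {p m} → Prime p → ¬ p ∣ m → Coprime m p
prime∤⇒coprime p-prime p∤m (c∣m , c∣p) with prime⇒irreducible p-prime c∣p
... | inj₁ c≡1  = c≡1
... | inj₂ refl = contradiction c∣m p∤m

coprime-^ʳ : ∀ {m n} k → Coprime m n → Coprime m (n ^ k)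
coprime-^ʳ zero    m⊥n (_ , c∣1)      = ∣1⇒≡1 c∣1
coprime-^ʳ (suc k) m⊥n (c∣m , c∣nnᵏ) =
  coprime-^ʳ k m⊥n (c∣m , coprime-divisor (λ (e∣c , e∣n) → m⊥n (∣-trans e∣c c∣m , e∣n)) c∣nnᵏ)

∣p^k⇒≡1⊎p∣ : ∀ {p d} k → Prime p → d ∣ p ^ k → d ≡ 1 ⊎ p ∣ d
∣p^k⇒≡1⊎p∣ {p} {d} k p-prime d∣pᵏ with p ∣? d
... | yes p∣d = inj₂ p∣d
... | no  p∤d = inj₁ (coprime-^ʳ k (prime∤⇒coprime p-prime p∤d) (∣-refl , d∣pᵏ))

σ-prime : ∀ {p} → Prime p → σ p ≡ 1 + p
σ-prime {p} p-prime = trans (σ≡sum (1≢p ∷ [] ∷ []) ∣⇒∈ ∈⇒∣) (cong suc (+-identityʳ p))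
  where
  instance
    p≢0 : NonZero p
    p≢0 = prime⇒nonZero p-prime
  1≢p : All (1 ≢_) (p ∷ [])
  1≢p = (prime≢1 p-prime ∘ sym) ∷ []
  ∣⇒∈ : ∀ {d} → d ∣ p → d ∈ 1 ∷ p ∷ []
  ∣⇒∈ d∣p with prime⇒irreducible p-prime d∣p
  ... | inj₁ refl = here refl
  ... | inj₂ refl = there (here refl)
  ∈⇒∣ : ∀ {d} → d ∈ 1 ∷ p ∷ [] → d ∣ p
  ∈⇒∣ (here refl)         = 1∣ p
  ∈⇒∣ (there (here refl)) = ∣-refl

-- Every divisor of p^k other than 1 is a multiple of p, so σ(p^k) ≡ 1 (mod p).
prime∤σ[p^k] : ∀ {p} k → Prime p → ¬ p ∣ σ (p ^ k)
prime∤σ[p^k] {p} k p-prime p∣σpᵏ =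
  prime≢1 p-prime (∣1⇒≡1 (∣m+n∣m⇒∣n (subst (p ∣_) (+-comm 1 (sum multiples)) p∣1+sum)
    (∣-sum (all-filter (p ∣?_) (divisors (p ^ k))))))
  where
  instance
    pᵏ≢0 : NonZero (p ^ k)
    pᵏ≢0 = m^n≢0 p k {{prime⇒nonZero p-prime}}
  multiples = filter (p ∣?_) (divisors (p ^ k))
  1∉multiples : All (1 ≢_) multiples
  1∉multiples = All.tabulate λ d∈ 1≡d →
    prime≢1 p-prime (∣1⇒≡1 (subst (p ∣_) (sym 1≡d) (proj₂ (∈-filter⁻ (p ∣?_) {xs = divisors (p ^ k)} d∈))))
  ∣⇒∈ : ∀ {d} → d ∣ p ^ k → d ∈ 1 ∷ multiples
  ∣⇒∈ d∣pᵏ with ∣p^k⇒≡1⊎p∣ k p-prime d∣pᵏ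
  ... | inj₁ refl = here refl
  ... | inj₂ p∣d  = there (∈-filter⁺ (p ∣?_) (∈-divisors⁺ d∣pᵏ) p∣d)
  ∈⇒∣ : ∀ {d} → d ∈ 1 ∷ multiples → d ∣ p ^ k
  ∈⇒∣ (here refl) = 1∣ (p ^ k)
  ∈⇒∣ (there d∈)  = ∈-divisors⁻ (p ^ k) (proj₁ (∈-filter⁻ (p ∣?_) {xs = divisors (p ^ k)} d∈))
  p∣1+sum : p ∣ 1 + sum multiples
  p∣1+sum = subst (p ∣_) (σ≡sum (1∉multiples ∷ Unique.filter⁺ (p ∣?_) (divisors-unique (p ^ k))) ∣⇒∈ ∈⇒∣) p∣σpᵏ

p^k∣cofactor : ∀ {p s m} k → Prime p → σ (p ^ k) * s ≡ 2 * (p ^ k * m) → p ^ k ∣ s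
p^k∣cofactor {p} {s} {m} k p-prime eq = coprime-divisor pᵏ⊥σpᵏ
  (subst (p ^ k ∣_) (sym eq) (∣-trans (m∣m*n m) (n∣m*n 2)))
  where
  pᵏ⊥σpᵏ : Coprime (p ^ k) (σ (p ^ k))
  pᵏ⊥σpᵏ = Coprimality.sym (coprime-^ʳ k (prime∤⇒coprime p-prime (prime∤σ[p^k] k p-prime)))

[1+q]s≡2qm⇒s≡qd∧d∣m : ∀ {q s m} .{{_ : NonZero q}} → q % 2 ≡ 1 → (1 + q) * s ≡ 2 * (q * m) →
  ∃[ d ] (s ≡ q * d × d ∣ m)
[1+q]s≡2qm⇒s≡qd∧d∣m {q} {s} {m} q%2≡1 eq = d , trans s≡dq (*-comm d q) , divides h (sym hd≡m)
  where
  q⊥1+q : Coprime q (1 + q)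
  q⊥1+q (c∣q , c∣1+q) = ∣1⇒≡1 (∣m+n∣m⇒∣n (subst (_∣_ _) (+-comm 1 q) c∣1+q) c∣q)
  q∣s : q ∣ s
  q∣s = coprime-divisor q⊥1+q
    (subst (q ∣_) (sym eq) (∣-trans (m∣m*n m) (n∣m*n 2)))
  d = quotient q∣s
  s≡dq : s ≡ d * q
  s≡dq = _∣_.equality q∣s
  suc-odd≡double-suc : ∀ j → 1 + (1 + j * 2) ≡ 2 * (1 + j)
  suc-odd≡double-suc = solve-∀
  regroup : ∀ x y z → 2 * (x * y) * z ≡ 2 * x * (y * z)
  regroup = solve-∀
  h = 1 + q / 2
  1+q≡2h : 1 + q ≡ 2 * h
  1+q≡2h = begin
    1 + q                   ≡⟨ cong (1 +_) (trans (m≡m%n+[m/n]*n q 2) (cong (_+ (q / 2) * 2) q%2≡1)) ⟩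
    1 + (1 + (q / 2) * 2)   ≡⟨ suc-odd≡double-suc (q / 2) ⟩
    2 * h                   ∎
  hd≡m : h * d ≡ m
  hd≡m = *-cancelˡ-≡ (h * d) m 2 (*-cancelʳ-≡ (2 * (h * d)) (2 * m) q (begin
    2 * (h * d) * q   ≡⟨ regroup h d q ⟩
    (2 * h) * (d * q) ≡⟨ cong₂ _*_ 1+q≡2h s≡dq ⟨
    (1 + q) * s       ≡⟨ eq ⟩
    2 * (q * m)       ≡⟨ cong (2 *_) (*-comm q m) ⟩
    2 * (m * q)       ≡⟨ *-assoc 2 m q ⟨
    2 * m * q         ∎))

p^k∣p*d⇒k≤1 : ∀ {p m d} k → Prime p → Coprime p m → d ∣ m → p ^ k ∣ p * d → k ≤ 1
p^k∣p*d⇒k≤1 zero          _       _   _   _ = z≤n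
p^k∣p*d⇒k≤1 (suc zero)    _       _   _   _ = s≤s z≤n
p^k∣p*d⇒k≤1 {p} (suc (suc k)) p-prime p⊥m d∣m pᵏ⁺²∣pd =
  contradiction (p⊥m (∣-refl , ∣-trans p∣d d∣m)) (prime≢1 p-prime)
  where
  instance
    p≢0 : NonZero p
    p≢0 = prime⇒nonZero p-prime
  p∣d : p ∣ _
  p∣d = ∣-trans (m∣m*n (p ^ k)) (*-cancelˡ-∣ p pᵏ⁺²∣pd)

lemma1 : (N q k n : ℕ) → 0 < N → Perfect N → ¬ (2 ∣ N) → N ≡ q ^ k * n ^ 2 →
    Prime q → q % 4 ≡ 1 → k % 4 ≡ 1 → Coprime q n →
    (k ≡ 1 ⇔ (∃[ d ] (σ (n ^ 2) ≡ q * d × d ∣ n ^ 2)))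
lemma1 N q k n N>0 perfect _ refl q-prime q%4≡1 k%4≡1 q⊥n = mk⇔ forward backward
  where
  instance
    q≢0 : NonZero q
    q≢0 = prime⇒nonZero q-prime
    qᵏ≢0 : NonZero (q ^ k)
    qᵏ≢0 = m^n≢0 q k
    n²≢0 : NonZero (n ^ 2)
    n²≢0 = m*n≢0⇒n≢0 (q ^ k) {{>-nonZero N>0}}
  q⊥n² : Coprime q (n ^ 2)
  q⊥n² = coprime-^ʳ 2 q⊥n
  σ-split : σ (q ^ k) * σ (n ^ 2) ≡ 2 * (q ^ k * n ^ 2)
  σ-split = trans (sym (σ-*-coprime (Coprimality.sym (coprime-^ʳ k (Coprimality.sym q⊥n²))))) perfect
  forward : k ≡ 1 → ∃[ d ] (σ (n ^ 2) ≡ q * d × d ∣ n ^ 2)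
  forward refl = [1+q]s≡2qm⇒s≡qd∧d∣m
    (trans (sym (m∣n⇒o%n%m≡o%m 2 4 q (divides 2 refl))) (cong (_% 2) q%4≡1))
    (trans (cong (_* σ (n ^ 2)) (sym (σ-prime q-prime)))
      (subst (λ Q → σ Q * σ (n ^ 2) ≡ 2 * (Q * n ^ 2)) (*-identityʳ q) σ-split))
  backward : ∃[ d ] (σ (n ^ 2) ≡ q * d × d ∣ n ^ 2) → k ≡ 1
  backward (d , σn²≡qd , d∣n²) with n≤1⇒n≡0∨n≡1 (p^k∣p*d⇒k≤1 k q-prime q⊥n² d∣n²
    (subst (q ^ k ∣_) σn²≡qd (p^k∣cofactor k q-prime σ-split)))
  ... | inj₁ k≡0 = contradiction (trans (cong (_% 4) (sym k≡0)) k%4≡1) λ ()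
  ... | inj₂ k≡1 = k≡1
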